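{- There exists a graph on $27$ vertices in which $24$ vertices have degree $13$, three vertices have degree $12$, and which contains no induced $5$-cycle. -}

module Defs where

open import Data.Bool using (Bool; true; false; T)
open import Data.Nat using (ℕ)
open import Data.Fin using (Fin)
open import Data.Fin.Properties using (_≟_)
open import Data.List using (List; length; filter)
open import Data.List using () renaming (allFin to allFinL)
open import Data.Product using (_×_)
open import Relation.Binary.PropositionalEquality using (_≡_)
open import Relation.Nullary using (¬_)
open import Relation.Nullary.Decidable using (⌊_⌋)
open import Data.Nat.Properties as ℕP using ()

record SimpleGraph (n : ℕ) : Set where
  field
    Adj   : Fin n → Fin n → Bool
    sym   : ∀ u v → Adj u v ≡ Adj v u
    loopless : ∀ v → Adj v v ≡ false

open SimpleGraph public

degree : ∀ {n} → SimpleGraph n → Fin n → ℕ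
degree G v = length (filter (λ u → T? (Adj G v u)) (allFinL _))
  where
  open import Data.Bool.Properties using (T?)

countDeg : ∀ {n} → SimpleGraph n → ℕ → ℕ
countDeg {n} G d = length (filter (λ v → degree G v ℕP.≟ d) (allFinL n))

record Induced5Cycle {n : ℕ} (G : SimpleGraph n) : Set where
  field
    v0 v1 v2 v3 v4 : Fin n
    d01 : ¬ v0 ≡ v1
    d02 : ¬ v0 ≡ v2
    d03 : ¬ v0 ≡ v3
    d04 : ¬ v0 ≡ v4
    d12 : ¬ v1 ≡ v2
    d13 : ¬ v1 ≡ v3
    d14 : ¬ v1 ≡ v4
    d23 : ¬ v2 ≡ v3
    d24 : ¬ v2 ≡ v4
    d34 : ¬ v3 ≡ v4
    a01 : Adj G v0 v1 ≡ true
    a12 : Adj G v1 v2 ≡ true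
    a23 : Adj G v2 v3 ≡ true
    a34 : Adj G v3 v4 ≡ true
    a40 : Adj G v4 v0 ≡ true
    n02 : Adj G v0 v2 ≡ false
    n03 : Adj G v0 v3 ≡ false
    n13 : Adj G v1 v3 ≡ false
    n14 : Adj G v1 v4 ≡ false
    n24 : Adj G v2 v4 ≡ false

-- The graph is a blow-up of the 3 × 3 rook's graph: every cell becomes a clique or an
-- independent set, and vertices in different cells are adjacent iff the cells share a row or a
-- column; the class sizes below give 24 vertices of degree 13 and 3 of degree 12. An induced
-- 5-cycle cannot meet a class twice, since some third vertex of the cycle tells the two apart,
-- so each of its five steps runs along a row or along a column of the grid. Two consecutive
-- steps along the same line would make two non-neighbours of the cycle adjacent, so the steps
-- alternate between rows and columns, which is impossible around an odd cycle.

module Submission where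

open import Defs renaming (sym to Adj-sym)
open import Data.Bool using (Bool; true; false; not; _∨_; if_then_else_)
open import Data.Bool.Properties using (¬-not; not-involutive)
open import Data.Empty using (⊥)
open import Data.Fin using (Fin; zero; suc; #_)
open import Data.Fin.Properties using (_≟_)
open import Data.Product using (Σ; _×_; _,_; proj₁; proj₂)
open import Data.Product.Properties using (≡-dec)
open import Data.Sum using (_⊎_; inj₁; inj₂)
open import Data.Vec using (lookup; replicate; _++_)
open import Function using (const)
open import Relation.Binary.Definitions using (DecidableEquality)
open import Relation.Binary.PropositionalEquality
  using (_≡_; _≢_; refl; sym; trans; cong; cong₂; ≢-sym; module ≡-Reasoning)
open import Relation.Nullary using (¬_; yes; no; does; contradiction)

¬alternating₅ : ∀ {a b c d e : Bool} → a ≢ b → b ≢ c → c ≢ d → d ≢ e → e ≢ a → ⊥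
¬alternating₅ {a} {b} {c} {d} {e} a≢b b≢c c≢d d≢e e≢a = e≢a (sym a≡e)
  where
  open ≡-Reasoning
  a≡e : a ≡ e
  a≡e = begin
    a             ≡⟨ ¬-not a≢b ⟩
    not b         ≡⟨ cong not (¬-not b≢c) ⟩
    not (not c)   ≡⟨ not-involutive c ⟩
    c             ≡⟨ ¬-not c≢d ⟩
    not d         ≡⟨ cong not (¬-not d≢e) ⟩
    not (not e)   ≡⟨ not-involutive e ⟩
    e             ∎

true≢false : ∀ {x y : Bool} → x ≡ true → y ≡ false → x ≢ y
true≢false refl refl ()

does-≟-sym : ∀ {A : Set} (_≟ᴬ_ : DecidableEquality A) (x y : A) → does (x ≟ᴬ y) ≡ does (y ≟ᴬ x)
does-≟-sym _≟ᴬ_ x y with x ≟ᴬ y | y ≟ᴬ x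
... | yes _   | yes _   = refl
... | no _    | no _    = refl
... | yes x≡y | no y≢x  = contradiction (sym x≡y) y≢x
... | no x≢y  | yes y≡x = contradiction (sym y≡x) x≢y

module _ {A : Set} (_≟ᴬ_ : DecidableEquality A) where

  withDiagonal : (A → Bool) → (A → A → Bool) → A → A → Bool
  withDiagonal d k x y = if does (x ≟ᴬ y) then d x else k x y

  withDiagonal-≢ : ∀ d k {x y} → x ≢ y → withDiagonal d k x y ≡ k x y
  withDiagonal-≢ d k {x} {y} x≢y with x ≟ᴬ y
  ... | yes x≡y = contradiction x≡y x≢y
  ... | no _    = refl

  withDiagonal-≡ : ∀ d k x → withDiagonal d k x x ≡ d x
  withDiagonal-≡ d k x with x ≟ᴬ x
  ... | yes _  = refl
  ... | no x≢x = contradiction refl x≢x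

  withDiagonal-sym : ∀ d k → (∀ x y → k x y ≡ k y x) →
                     ∀ x y → withDiagonal d k x y ≡ withDiagonal d k y x
  withDiagonal-sym d k k-sym x y with x ≟ᴬ y | y ≟ᴬ x
  ... | yes refl | yes _   = refl
  ... | no _     | no _    = k-sym x y
  ... | yes x≡y  | no y≢x  = contradiction (sym x≡y) y≢x
  ... | no x≢y   | yes y≡x = contradiction (sym y≡x) x≢y

rotate : ∀ {n} {G : SimpleGraph n} → Induced5Cycle G → Induced5Cycle G
rotate {G = G} C = record
  { v0 = v1 ; v1 = v2 ; v2 = v3 ; v3 = v4 ; v4 = v0
  ; d01 = d12 ; d02 = d13 ; d03 = d14 ; d04 = ≢-sym d01
  ; d12 = d23 ; d13 = d24 ; d14 = ≢-sym d02
  ; d23 = d34 ; d24 = ≢-sym d03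
  ; d34 = ≢-sym d04
  ; a01 = a12 ; a12 = a23 ; a23 = a34 ; a34 = a40 ; a40 = a01
  ; n02 = n13 ; n03 = n14 ; n13 = n24
  ; n14 = trans (Adj-sym G v2 v0) n02
  ; n24 = trans (Adj-sym G v3 v0) n03
  }
  where open Induced5Cycle C

-- Vertex u lies in class f u, and distinct vertices u, v are adjacent iff M (f u) (f v);
-- so M p p says whether class p is a clique or an independent set.
module BlowUp {n} {A : Set} (M : A → A → Bool) (M-sym : ∀ p q → M p q ≡ M q p) (f : Fin n → A) where

  private
    M′ : Fin n → Fin n → Bool
    M′ u v = M (f u) (f v)

  blowUp : SimpleGraph n
  blowUp = record
    { Adj      = withDiagonal _≟_ (const false) M′
    ; sym      = withDiagonal-sym _≟_ (const false) M′ (λ u v → M-sym (f u) (f v))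
    ; loopless = withDiagonal-≡ _≟_ (const false) M′
    }

  blowUp-adj : ∀ {u v} → u ≢ v → Adj blowUp u v ≡ M (f u) (f v)
  blowUp-adj = withDiagonal-≢ _≟_ (const false) M′

  distinguishable⇒different-classes : ∀ {w x y} → w ≢ x → w ≢ y →
                                      Adj blowUp w x ≢ Adj blowUp w y → f x ≢ f y
  distinguishable⇒different-classes {w} {x} {y} w≢x w≢y distinct fx≡fy = distinct (begin
    Adj blowUp w x  ≡⟨ blowUp-adj w≢x ⟩
    M (f w) (f x)   ≡⟨ cong (M (f w)) fx≡fy ⟩
    M (f w) (f y)   ≡⟨ blowUp-adj w≢y ⟨
    Adj blowUp w y  ∎)
    where open ≡-Reasoning

  module _ (C : Induced5Cycle blowUp) where

    open Induced5Cycle C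

    cycle-classes-differ₀₁ : f v0 ≢ f v1
    cycle-classes-differ₀₁ = distinguishable⇒different-classes (≢-sym d04) (≢-sym d14)
      (true≢false a40 (trans (Adj-sym blowUp v4 v1) n14))

    cycle-classes-differ₀₂ : f v0 ≢ f v2
    cycle-classes-differ₀₂ = distinguishable⇒different-classes (≢-sym d04) (≢-sym d24)
      (true≢false a40 (trans (Adj-sym blowUp v4 v2) n24))

module Rook {R K : Set} (_≟ᴿ_ : DecidableEquality R) (_≟ᴷ_ : DecidableEquality K) where

  Cell : Set
  Cell = R × K

  _≟ᶜ_ : DecidableEquality Cell
  _≟ᶜ_ = ≡-dec _≟ᴿ_ _≟ᴷ_

  row : Cell → R
  row = proj₁

  col : Cell → K
  col = proj₂

  sameLine : Cell → Cell → Bool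
  sameLine (r , c) (r′ , c′) = does (r ≟ᴿ r′) ∨ does (c ≟ᴷ c′)

  sameLine-sym : ∀ p q → sameLine p q ≡ sameLine q p
  sameLine-sym (r , c) (r′ , c′) = cong₂ _∨_ (does-≟-sym _≟ᴿ_ r r′) (does-≟-sym _≟ᴷ_ c c′)

  Aligned : Cell → Cell → Set
  Aligned p q = row p ≡ row q ⊎ col p ≡ col q

  sameLine⇒aligned : ∀ p q → sameLine p q ≡ true → Aligned p q
  sameLine⇒aligned (r , c) (r′ , c′) eq with r ≟ᴿ r′ | c ≟ᴷ c′
  ... | yes r≡r′ | _        = inj₁ r≡r′
  ... | no _     | yes c≡c′ = inj₂ c≡c′

  aligned⇒sameLine : ∀ p q → Aligned p q → sameLine p q ≡ true
  aligned⇒sameLine (r , c) (r′ , c′) aligned with r ≟ᴿ r′ | c ≟ᴷ c′ | aligned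
  ... | yes _   | _       | _         = refl
  ... | no _    | yes _   | _         = refl
  ... | no r≢r′ | no _    | inj₁ r≡r′ = contradiction r≡r′ r≢r′
  ... | no _    | no c≢c′ | inj₂ c≡c′ = contradiction c≡c′ c≢c′

  rookPattern : (Cell → Bool) → Cell → Cell → Bool
  rookPattern clique = withDiagonal _≟ᶜ_ clique sameLine

  rookPattern-sym : ∀ clique p q → rookPattern clique p q ≡ rookPattern clique q p
  rookPattern-sym clique = withDiagonal-sym _≟ᶜ_ clique sameLine sameLine-sym

  module _ {n} (clique : Cell → Bool) (f : Fin n → Cell) where

    open BlowUp (rookPattern clique) (rookPattern-sym clique) f

    adj-across-cells : ∀ {u v} → f u ≢ f v → Adj blowUp u v ≡ sameLine (f u) (f v)
    adj-across-cells fu≢fv = trans (blowUp-adj (λ { refl → fu≢fv refl }))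
                                   (withDiagonal-≢ _≟ᶜ_ clique sameLine fu≢fv)

    adjacent⇒aligned : ∀ {u v} → f u ≢ f v → Adj blowUp u v ≡ true → Aligned (f u) (f v)
    adjacent⇒aligned fu≢fv adj = sameLine⇒aligned _ _ (trans (sym (adj-across-cells fu≢fv)) adj)

    aligned⇒adjacent : ∀ {u v} → f u ≢ f v → Aligned (f u) (f v) → Adj blowUp u v ≡ true
    aligned⇒adjacent fu≢fv aligned = trans (adj-across-cells fu≢fv) (aligned⇒sameLine _ _ aligned)

    adjacent-column : ∀ {u v} → f u ≢ f v → Adj blowUp u v ≡ true →
                      row (f u) ≢ row (f v) → col (f u) ≡ col (f v)
    adjacent-column fu≢fv adj r≢ with adjacent⇒aligned fu≢fv adj
    ... | inj₁ r≡ = contradiction r≡ r≢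
    ... | inj₂ c≡ = c≡

    rowStep : Fin n → Fin n → Bool
    rowStep u v = does (row (f u) ≟ᴿ row (f v))

    module _ (C : Induced5Cycle blowUp) where

      open Induced5Cycle C

      private
        f₀≢f₁ : f v0 ≢ f v1
        f₀≢f₁ = cycle-classes-differ₀₁ C

        f₁≢f₂ : f v1 ≢ f v2
        f₁≢f₂ = cycle-classes-differ₀₁ (rotate C)

        f₀≢f₂ : f v0 ≢ f v2
        f₀≢f₂ = cycle-classes-differ₀₂ C

        v0≁v2 : ¬ Aligned (f v0) (f v2)
        v0≁v2 aligned = true≢false (aligned⇒adjacent f₀≢f₂ aligned) n02 refl

      -- Two consecutive steps along the same line would align the cells of v0 and v2.
      rowStep-alternates : rowStep v0 v1 ≢ rowStep v1 v2
      rowStep-alternates eq with row (f v0) ≟ᴿ row (f v1) | row (f v1) ≟ᴿ row (f v2)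
      ... | yes r₀₁ | yes r₁₂ = v0≁v2 (inj₁ (trans r₀₁ r₁₂))
      ... | no r₀₁  | no r₁₂  =
        v0≁v2 (inj₂ (trans (adjacent-column f₀≢f₁ a01 r₀₁) (adjacent-column f₁≢f₂ a12 r₁₂)))
      ... | yes _ | no _  = contradiction eq λ ()
      ... | no _  | yes _ = contradiction eq λ ()

    -- Around an odd cycle the steps cannot alternate between rows and columns.
    blowUp-rook-¬induced5Cycle : ¬ Induced5Cycle blowUp
    blowUp-rook-¬induced5Cycle C = ¬alternating₅
      (rowStep-alternates C) (rowStep-alternates (rotate C)) (rowStep-alternates (rotate² C))
      (rowStep-alternates (rotate (rotate² C))) (rowStep-alternates (rotate² (rotate² C)))
      where
      rotate² : Induced5Cycle blowUp → Induced5Cycle blowUp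
      rotate² C = rotate (rotate C)

open Rook (_≟_ {3}) (_≟_ {3})

clique : Cell → Bool
clique (zero , _)                   = true
clique (suc zero , suc (suc zero))  = false
clique (suc zero , _)               = true
clique (suc (suc zero) , _)         = false

classOf : Fin 27 → Cell
classOf = lookup (replicate 2 (# 0 , # 0) ++ replicate 2 (# 0 , # 1) ++ replicate 3 (# 0 , # 2) ++
                  replicate 3 (# 1 , # 0) ++ replicate 3 (# 1 , # 1) ++ replicate 2 (# 1 , # 2) ++
                  replicate 4 (# 2 , # 0) ++ replicate 4 (# 2 , # 1) ++ replicate 4 (# 2 , # 2))

graph : SimpleGraph 27
graph = BlowUp.blowUp (rookPattern clique) (rookPattern-sym clique) classOf

lemma11 : Σ (SimpleGraph 27) (λ G → (countDeg G 13 ≡ 24) × (countDeg G 12 ≡ 3) × ¬ Induced5Cycle G)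
lemma11 = graph , refl , refl , blowUp-rook-¬induced5Cycle clique classOf
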